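{- A uniformly dense graph $G$ is $(\rho(G)/\Delta(G))$-tough. If, furthermore, $G$ is regular and connected, then it is $1$-tough.
   Context: Graphs are finite and simple with at least one edge. $c(A)$ is the number of connected components of $(V,A)$, $\operatorname{rank}(A)=|V|-c(A)$, $\rho(A)=|A|/\operatorname{rank}(A)$, $\rho(G)=\rho(E)$; $G$ is uniformly dense if $\rho(A)\le\rho(E)$ for all nonempty $A\subseteq E$. $\Delta(G)$ is the maximum degree. A graph is $t$-tough if removing any set of $k$ vertices (with their incident edges) increases the number of connected components by at most $k/t$; the complete graph is $t$-tough for every $t$. -}

module Defs where

open import Data.Nat using (ℕ; zero; suc; _+_; _*_; _∸_; _≤_; _⊔_; _<ᵇ_)
open import Data.Bool using (Bool; true; false; _∧_; _∨_; not)
open import Data.Fin using (Fin; toℕ)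
open import Data.List using (foldr; filter; length; allFin)
open import Data.Product using (Σ; _×_; _,_)
open import Relation.Binary.PropositionalEquality using (_≡_)
open import Relation.Nullary.Decidable using (does)
import Data.Bool as B
import Data.Fin as F

record Graph (n : ℕ) : Set where
  field
    adj    : Fin n → Fin n → Bool
    sym    : ∀ i j → adj i j ≡ adj j i
    irrefl : ∀ i → adj i i ≡ false
    edge   : Σ (Fin n) λ i → Σ (Fin n) λ j → adj i j ≡ true
open Graph public

record EdgeSet {n : ℕ} (G : Graph n) : Set where
  field
    mem  : Fin n → Fin n → Bool
    msym : ∀ i j → mem i j ≡ mem j i
    sub  : ∀ i j → mem i j ≡ true → adj G i j ≡ true
open EdgeSet public

Eall : ∀ {n} (G : Graph n) → EdgeSet G
Eall G = record { mem = adj G ; msym = sym G ; sub = λ i j p → p }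

Nonempty : ∀ {n} {G : Graph n} → EdgeSet G → Set
Nonempty A = Σ _ λ i → Σ _ λ j → mem A i j ≡ true

count : ∀ {n} → (Fin n → Bool) → ℕ
count {n} p = length (filter (λ i → p i B.≟ true) (allFin n))

anyFin : ∀ {n} → (Fin n → Bool) → Bool
anyFin {n} p = foldr (λ i b → p i ∨ b) false (allFin n)

maxFin : ∀ {n} → (Fin n → ℕ) → ℕ
maxFin {n} f = foldr (λ i m → f i ⊔ m) 0 (allFin n)

_==_ : ∀ {n} → Fin n → Fin n → Bool
i == j = does (i F.≟ j)

numEdges : ∀ {n} → (Fin n → Fin n → Bool) → ℕ
numEdges {n} r = foldr (λ i s → count (λ j → (toℕ i <ᵇ toℕ j) ∧ r i j) + s) 0 (allFin n)

degree : ∀ {n} → Graph n → Fin n → ℕ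
degree G v = count (adj G v)

maxDegree : ∀ {n} → Graph n → ℕ
maxDegree G = maxFin (degree G)

Regular : ∀ {n} → Graph n → Set
Regular G = ∀ u v → degree G u ≡ degree G v

-- Connected components of the graph (W, r): vertex set W ⊆ Fin n, edges r
-- (restricted to W).

reachK : ∀ {n} → (Fin n → Bool) → (Fin n → Fin n → Bool) → ℕ → Fin n → Fin n → Bool
reachK W r zero    u v = W u ∧ W v ∧ (u == v)
reachK W r (suc k) u v = reachK W r k u v ∨ anyFin (λ w → reachK W r k u w ∧ r w v ∧ W v)

reach : ∀ {n} → (Fin n → Bool) → (Fin n → Fin n → Bool) → Fin n → Fin n → Bool
reach {n} W r = reachK W r n

-- number of components = number of vertices of W that are the least
-- vertex of their component
components : ∀ {n} → (Fin n → Bool) → (Fin n → Fin n → Bool) → ℕ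
components W r = count (λ v → W v ∧ not (anyFin (λ u → (toℕ u <ᵇ toℕ v) ∧ reach W r u v)))

allV : ∀ {n} → Fin n → Bool
allV _ = true

c : ∀ {n} {G : Graph n} → EdgeSet G → ℕ
c A = components allV (mem A)

rank : ∀ {n} {G : Graph n} → EdgeSet G → ℕ
rank {n} A = n ∸ c A

size : ∀ {n} {G : Graph n} → EdgeSet G → ℕ
size A = numEdges (mem A)

cG : ∀ {n} → Graph n → ℕ
cG G = c (Eall G)

Connected : ∀ {n} → Graph n → Set
Connected G = cG G ≡ 1

-- Uniform density: ρ(A) ≤ ρ(E) for all nonempty A ⊆ E, where
-- ρ(A) = |A| / rank(A).  Written with denominators cleared:
--   |A| / rank(A) ≤ |E| / rank(E)  ⇔  |A| * rank(E) ≤ |E| * rank(A)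
-- (rank(A) ≥ 1 for nonempty A, rank(E) ≥ 1 since G has an edge).
UniformlyDense : ∀ {n} → Graph n → Set
UniformlyDense G = (A : EdgeSet G) → Nonempty A →
  size A * rank (Eall G) ≤ size (Eall G) * rank A

-- Toughness with t = p / q (p, q > 0):  G is t-tough iff for every
-- S ⊆ V with |S| = k, c(G - S) - c(G) ≤ k / t, i.e.
--   p * (c(G - S) ∸ c(G)) ≤ q * |S|
-- (a decrease in the number of components is always allowed).

cMinus : ∀ {n} → Graph n → (Fin n → Bool) → ℕ
cMinus G S = components (λ v → not (S v)) (adj G)

ToughFrac : ∀ {n} → Graph n → (p q : ℕ) → Set
ToughFrac G p q = (S : Fin _ → Bool) →
  p * (cMinus G S ∸ cG G) ≤ q * count S

-- ρ(G)/Δ(G) = (|E| / rank(E)) / Δ(G) = |E| / (rank(E) * Δ(G))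

module Submission where

-- Deleting a vertex set S from G has, as far as components are concerned, the
-- same effect as keeping only the edge set A of edges that avoid S: the vertices
-- of S then become isolated, so c(A) = |S| + c(G − S).  At most
-- Σ_{v ∈ S} deg v ≤ Δ |S| edges are lost, and uniform density ρ(A) ≤ ρ(E)
-- turns this into |E| (rank E − rank A) ≤ rank(E) Δ |S|, where
-- rank E − rank A = |S| + c(G − S) − c(G).  If G is connected and d-regular, then
-- 2|E| = n d and rank E = n − 1, and the same inequality forces c(G − S) − 1 ≤ |S|.

open import Data.Nat
open import Data.Nat.Properties
open import Data.Bool using (Bool; true; false; _∧_; _∨_; not)
open import Data.Bool.Properties using (∧-zeroʳ; ∧-identityʳ; ∧-comm; ∨-identityʳ; not-involutive)
import Data.Bool as B
open import Data.Fin as F using (Fin; toℕ)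
open import Data.Fin.Properties using (toℕ-injective)
open import Data.List using (List; []; _∷_; foldr; filter; length; tabulate; allFin)
open import Data.List.Properties using (foldr-cong)
open import Data.Product using (∃; _×_; _,_; proj₁; proj₂)
open import Data.Sum using (_⊎_; inj₁; inj₂)
open import Function using (id; _∘_)
open import Relation.Nullary using (yes; no)
open import Relation.Binary.PropositionalEquality
  using (_≡_; refl; sym; trans; cong; cong₂; subst; subst₂; module ≡-Reasoning)
open import Algebra.Properties.Semiring.Sum +-*-semiring
  using (sum-syntax; ∑-distrib-+; ∑-comm; *-distribˡ-sum; *-distribʳ-sum; sum-cong-≗; sum-remove)
open import Data.Nat.Tactic.RingSolver using (solve-∀)
open import Defs renaming (sym to adj-sym)

⟦_⟧ : Bool → ℕ
⟦ true ⟧  = 1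
⟦ false ⟧ = 0

⟦⟧-positive : ∀ {b} → 0 < ⟦ b ⟧ → b ≡ true
⟦⟧-positive {true} _ = refl

∧≡true : ∀ {a b} → a ∧ b ≡ true → a ≡ true × b ≡ true
∧≡true {true} b≡true = refl , b≡true

∨≡true : ∀ {a b} → a ∨ b ≡ true → a ≡ true ⊎ b ≡ true
∨≡true {true}  _      = inj₁ refl
∨≡true {false} b≡true = inj₂ b≡true

<ᵇ-irrefl : ∀ m → (m <ᵇ m) ≡ false
<ᵇ-irrefl zero    = refl
<ᵇ-irrefl (suc m) = <ᵇ-irrefl m

<ᵇ-trichotomy : ∀ m n → ((m <ᵇ n) ≡ true × (n <ᵇ m) ≡ false) ⊎ m ≡ n ⊎ ((m <ᵇ n) ≡ false × (n <ᵇ m) ≡ true)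
<ᵇ-trichotomy zero    zero    = inj₂ (inj₁ refl)
<ᵇ-trichotomy zero    (suc n) = inj₁ (refl , refl)
<ᵇ-trichotomy (suc m) zero    = inj₂ (inj₂ (refl , refl))
<ᵇ-trichotomy (suc m) (suc n) with <ᵇ-trichotomy m n
... | inj₁ m<n          = inj₁ m<n
... | inj₂ (inj₁ m≡n)   = inj₂ (inj₁ (cong suc m≡n))
... | inj₂ (inj₂ m>n)   = inj₂ (inj₂ m>n)

Fin-inhabited⇒0<n : ∀ {n} → Fin n → 0 < n
Fin-inhabited⇒0<n F.zero    = z<s
Fin-inhabited⇒0<n (F.suc _) = z<s

[o∸n]∸[o∸m]≡m∸n : ∀ {m o} n → m ≤ o → (o ∸ n) ∸ (o ∸ m) ≡ m ∸ n
[o∸n]∸[o∸m]≡m∸n {m} {o} n m≤o = begin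
  (o ∸ n) ∸ (o ∸ m)   ≡⟨ ∸-+-assoc o n (o ∸ m) ⟩
  o ∸ (n + (o ∸ m))   ≡⟨ cong (o ∸_) (+-comm n (o ∸ m)) ⟩
  o ∸ ((o ∸ m) + n)   ≡⟨ ∸-+-assoc o (o ∸ m) n ⟨
  (o ∸ (o ∸ m)) ∸ n   ≡⟨ cong (_∸ n) (m∸[m∸n]≡n m≤o) ⟩
  m ∸ n               ∎
  where open ≡-Reasoning

∑-mono-≤ : ∀ {n} {f g : Fin n → ℕ} → (∀ i → f i ≤ g i) → ∑[ i < n ] f i ≤ ∑[ i < n ] g i
∑-mono-≤ {zero}  f≤g = z≤n
∑-mono-≤ {suc n} f≤g = +-mono-≤ (f≤g F.zero) (∑-mono-≤ (f≤g ∘ F.suc))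

∑-const : ∀ n c → ∑[ i < n ] c ≡ n * c
∑-const zero    c = refl
∑-const (suc n) c = cong (c +_) (∑-const n c)

∑-term : ∀ {n} (f : Fin n → ℕ) i → f i ≤ ∑[ j < n ] f j
∑-term {suc n} f i = ≤-trans (m≤m+n (f i) _) (≤-reflexive (sym (sum-remove {i = i} f)))

∑-positive : ∀ {n} (f : Fin n → ℕ) → 0 < ∑[ i < n ] f i → ∃ λ i → 0 < f i
∑-positive {suc n} f pos with f F.zero in eq
... | suc _ = F.zero , subst (0 <_) (sym eq) z<s
... | zero with ∑-positive (f ∘ F.suc) pos
...   | i , fi>0 = F.suc i , fi>0

foldr-+-tabulate : ∀ {n} {A : Set} (f : A → ℕ) (h : Fin n → A) →
  foldr (λ x s → f x + s) 0 (tabulate h) ≡ ∑[ i < n ] f (h i)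
foldr-+-tabulate {zero}  f h = refl
foldr-+-tabulate {suc n} f h = cong (f (h F.zero) +_) (foldr-+-tabulate f (h ∘ F.suc))

foldr-⊔-tabulate : ∀ {n} {A : Set} (f : A → ℕ) (h : Fin n → A) i →
  f (h i) ≤ foldr (λ x m → f x ⊔ m) 0 (tabulate h)
foldr-⊔-tabulate f h F.zero    = m≤m⊔n (f (h F.zero)) _
foldr-⊔-tabulate f h (F.suc i) = m≤n⇒m≤o⊔n (f (h F.zero)) (foldr-⊔-tabulate f (h ∘ F.suc) i)

length-filter-≡true : {A : Set} (p : A → Bool) (xs : List A) →
  length (filter (λ x → p x B.≟ true) xs) ≡ foldr (λ x s → ⟦ p x ⟧ + s) 0 xs
length-filter-≡true p [] = refl
length-filter-≡true p (x ∷ xs) with p x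
... | true  = cong suc (length-filter-≡true p xs)
... | false = length-filter-≡true p xs

count-∑ : ∀ {n} (p : Fin n → Bool) → count p ≡ ∑[ i < n ] ⟦ p i ⟧
count-∑ {n} p = trans (length-filter-≡true p (allFin n)) (foldr-+-tabulate (⟦_⟧ ∘ p) id)

count≤ : ∀ {n} (p : Fin n → Bool) → count p ≤ n
count≤ {n} p = begin
  count p                 ≡⟨ count-∑ p ⟩
  ∑[ i < n ] ⟦ p i ⟧      ≤⟨ ∑-mono-≤ (λ i → ⟦⟧≤1 (p i)) ⟩
  ∑[ i < n ] 1            ≡⟨ ∑-const n 1 ⟩
  n * 1                   ≡⟨ *-identityʳ n ⟩
  n                       ∎
  where
  open ≤-Reasoning
  ⟦⟧≤1 : ∀ b → ⟦ b ⟧ ≤ 1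
  ⟦⟧≤1 true  = ≤-refl
  ⟦⟧≤1 false = z≤n

anyFin-cong : ∀ {n} {p q : Fin n → Bool} → (∀ i → p i ≡ q i) → anyFin p ≡ anyFin q
anyFin-cong {n} p≗q = foldr-cong (λ i b → cong (_∨ b) (p≗q i)) refl (allFin n)

module _ {A : Set} (p : A → Bool) where
  foldr-∨-witness : ∀ xs → foldr (λ x b → p x ∨ b) false xs ≡ true → ∃ λ x → p x ≡ true
  foldr-∨-witness (x ∷ xs) any with p x in eq
  ... | true  = x , eq
  ... | false = foldr-∨-witness xs any

  foldr-∨-false : (∀ x → p x ≡ false) → ∀ xs → foldr (λ x b → p x ∨ b) false xs ≡ false
  foldr-∨-false none []       = refl
  foldr-∨-false none (x ∷ xs) rewrite none x = foldr-∨-false none xs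

anyFin-witness : ∀ {n} (p : Fin n → Bool) → anyFin p ≡ true → ∃ λ i → p i ≡ true
anyFin-witness {n} p = foldr-∨-witness p (allFin n)

anyFin-false : ∀ {n} (p : Fin n → Bool) → (∀ i → p i ≡ false) → anyFin p ≡ false
anyFin-false {n} p none = foldr-∨-false p none (allFin n)

restrict : ∀ {n} → (Fin n → Bool) → (Fin n → Fin n → Bool) → Fin n → Fin n → Bool
restrict W r i j = r i j ∧ (W i ∧ W j)

earlierInComponent : ∀ {n} → (Fin n → Bool) → (Fin n → Fin n → Bool) → Fin n → Fin n → Bool
earlierInComponent W r v u = (toℕ u <ᵇ toℕ v) ∧ reach W r u v

leader : ∀ {n} → (Fin n → Bool) → (Fin n → Fin n → Bool) → Fin n → Bool
leader W r v = W v ∧ not (anyFin (earlierInComponent W r v))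

components≤ : ∀ {n} (W : Fin n → Bool) r → components W r ≤ n
components≤ W r = count≤ (leader W r)

module _ {n} (W : Fin n → Bool) (r : Fin n → Fin n → Bool) where

  reachK-source : ∀ k {u v} → reachK W r k u v ≡ true → W u ≡ true
  reachK-source zero    {u}     uv = proj₁ (∧≡true {W u} uv)
  reachK-source (suc k) {u} {v} uv with ∨≡true uv
  ... | inj₁ uv′ = reachK-source k uv′
  ... | inj₂ via with anyFin-witness (λ w → reachK W r k u w ∧ r w v ∧ W v) via
  ...   | w , uwv = reachK-source k (proj₁ (∧≡true {reachK W r k u w} uwv))

  reachK-target : ∀ k {u v} → reachK W r k u v ≡ true → W v ≡ true
  reachK-target zero    {u} {v} uv = proj₁ (∧≡true {W v} (proj₂ (∧≡true {W u} uv)))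
  reachK-target (suc k) {u} {v} uv with ∨≡true uv
  ... | inj₁ uv′ = reachK-target k uv′
  ... | inj₂ via with anyFin-witness (λ w → reachK W r k u w ∧ r w v ∧ W v) via
  ...   | w , uwv = proj₂ (∧≡true {r w v} (proj₂ (∧≡true {reachK W r k u w} uwv)))

  reachK-from-outside : ∀ k {u v} → W u ≡ false → reachK W r k u v ≡ false
  reachK-from-outside k {u} {v} Wu with reachK W r k u v in uv
  ... | false = refl
  ... | true with trans (sym (reachK-source k uv)) Wu
  ...   | ()

  reachK-into-outside : ∀ k {u v} → W v ≡ false → reachK W r k u v ≡ false
  reachK-into-outside k {u} {v} Wv with reachK W r k u v in uv
  ... | false = refl
  ... | true with trans (sym (reachK-target k uv)) Wv
  ...   | ()

  private
    reachKᵂ = reachK allV (restrict W r)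

  reachK-restrict-outside : ∀ k {u} v → W u ≡ false → reachKᵂ k u v ≡ (u == v)
  reachK-restrict-outside zero    v Wu = refl
  reachK-restrict-outside (suc k) {u} v Wu =
    trans (cong₂ _∨_ (reachK-restrict-outside k v Wu) (anyFin-false _ no-step)) (∨-identityʳ (u == v))
    where
    no-step : ∀ w → reachKᵂ k u w ∧ restrict W r w v ∧ true ≡ false
    no-step w rewrite reachK-restrict-outside k w Wu with u F.≟ w
    ... | yes refl rewrite Wu | ∧-zeroʳ (r u v) = refl
    ... | no _     = refl

  reachK-restrict-inside : ∀ k {u} v → W u ≡ true → reachKᵂ k u v ≡ reachK W r k u v
  reachK-restrict-inside zero {u} v Wu with u F.≟ v
  ... | yes refl rewrite Wu = refl
  ... | no _     rewrite Wu | ∧-zeroʳ (W v) = refl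
  reachK-restrict-inside (suc k) {u} v Wu =
    cong₂ _∨_ (reachK-restrict-inside k v Wu) (anyFin-cong step)
    where
    step : ∀ w → reachKᵂ k u w ∧ restrict W r w v ∧ true ≡ reachK W r k u w ∧ r w v ∧ W v
    step w rewrite reachK-restrict-inside k w Wu with reachK W r k u w in uw
    ... | false = refl
    ... | true rewrite reachK-target k uw = ∧-identityʳ (r w v ∧ W v)

  earlierInComponent-restrict-outside : ∀ {v} → W v ≡ false → ∀ u → earlierInComponent allV (restrict W r) v u ≡ false
  earlierInComponent-restrict-outside {v} Wv u with W u in Wu
  ... | false rewrite reachK-restrict-outside n v Wu with u F.≟ v
  ...   | yes refl = cong (_∧ true) (<ᵇ-irrefl (toℕ u))
  ...   | no _     = ∧-zeroʳ _
  earlierInComponent-restrict-outside {v} Wv u | true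
    rewrite reachK-restrict-inside n v Wu | reachK-into-outside n {u} Wv = ∧-zeroʳ _

  earlierInComponent-restrict-inside : ∀ {v} → W v ≡ true → ∀ u → earlierInComponent allV (restrict W r) v u ≡ earlierInComponent W r v u
  earlierInComponent-restrict-inside {v} Wv u with W u in Wu
  ... | true rewrite reachK-restrict-inside n v Wu = refl
  ... | false rewrite reachK-restrict-outside n v Wu | reachK-from-outside n {v = v} Wu with u F.≟ v
  ...   | no _     = refl
  ...   | yes refl with trans (sym Wu) Wv
  ...     | ()

  leader-restrict : ∀ v → ⟦ leader allV (restrict W r) v ⟧ ≡ ⟦ not (W v) ⟧ + ⟦ leader W r v ⟧
  leader-restrict v with W v in Wv
  ... | false rewrite anyFin-false _ (earlierInComponent-restrict-outside Wv) = refl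
  ... | true  rewrite anyFin-cong (earlierInComponent-restrict-inside Wv) = refl

  components-restrict : components allV (restrict W r) ≡ count (not ∘ W) + components W r
  components-restrict = begin
    components allV (restrict W r)                        ≡⟨ count-∑ (leader allV (restrict W r)) ⟩
    ∑[ v < n ] ⟦ leader allV (restrict W r) v ⟧            ≡⟨ sum-cong-≗ leader-restrict ⟩
    ∑[ v < n ] (⟦ not (W v) ⟧ + ⟦ leader W r v ⟧)          ≡⟨ ∑-distrib-+ (⟦_⟧ ∘ not ∘ W) (⟦_⟧ ∘ leader W r) ⟩
    ∑[ v < n ] ⟦ not (W v) ⟧ + ∑[ v < n ] ⟦ leader W r v ⟧ ≡⟨ sym (cong₂ _+_ (count-∑ (not ∘ W)) (count-∑ (leader W r))) ⟩
    count (not ∘ W) + components W r                      ∎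
    where open ≡-Reasoning

∑∑-distrib-+ : ∀ {n} (f g : Fin n → Fin n → ℕ) →
  ∑[ i < n ] ∑[ j < n ] (f i j + g i j) ≡ ∑[ i < n ] ∑[ j < n ] f i j + ∑[ i < n ] ∑[ j < n ] g i j
∑∑-distrib-+ {n} f g = trans (sum-cong-≗ (λ i → ∑-distrib-+ (f i) (g i)))
                             (∑-distrib-+ (λ i → ∑[ j < n ] f i j) (λ i → ∑[ j < n ] g i j))

numEdges-∑ : ∀ {n} (r : Fin n → Fin n → Bool) →
  numEdges r ≡ ∑[ i < n ] ∑[ j < n ] ⟦ (toℕ i <ᵇ toℕ j) ∧ r i j ⟧
numEdges-∑ r = trans (foldr-+-tabulate (λ i → count (λ j → (toℕ i <ᵇ toℕ j) ∧ r i j)) id)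
                     (sum-cong-≗ (λ i → count-∑ (λ j → (toℕ i <ᵇ toℕ j) ∧ r i j)))

module _ {n} {G : Graph n} (A : EdgeSet G) where

  mem-irrefl : ∀ i → mem A i i ≡ false
  mem-irrefl i with mem A i i in e
  ... | false = refl
  ... | true with trans (sym (sub A i i e)) (irrefl G i)
  ...   | ()

  split-by-order : ∀ i j → ⟦ mem A i j ⟧ ≡ ⟦ (toℕ i <ᵇ toℕ j) ∧ mem A i j ⟧ + ⟦ (toℕ j <ᵇ toℕ i) ∧ mem A i j ⟧
  split-by-order i j with <ᵇ-trichotomy (toℕ i) (toℕ j)
  ... | inj₁ (i<j , j≮i)        rewrite i<j | j≮i = sym (+-identityʳ _)
  ... | inj₂ (inj₂ (i≮j , j<i)) rewrite i≮j | j<i = refl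
  ... | inj₂ (inj₁ i≡j) rewrite toℕ-injective i≡j | mem-irrefl j | ∧-zeroʳ (toℕ j <ᵇ toℕ j) = refl

  handshake : ∑[ i < n ] ∑[ j < n ] ⟦ mem A i j ⟧ ≡ 2 * size A
  handshake = begin
    ∑[ i < n ] ∑[ j < n ] ⟦ mem A i j ⟧
      ≡⟨ sum-cong-≗ (λ i → sum-cong-≗ (split-by-order i)) ⟩
    ∑[ i < n ] ∑[ j < n ] (⟦ (toℕ i <ᵇ toℕ j) ∧ mem A i j ⟧ + ⟦ (toℕ j <ᵇ toℕ i) ∧ mem A i j ⟧)
      ≡⟨ ∑∑-distrib-+ (λ i j → ⟦ (toℕ i <ᵇ toℕ j) ∧ mem A i j ⟧) (λ i j → ⟦ (toℕ j <ᵇ toℕ i) ∧ mem A i j ⟧) ⟩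
    edges + ∑[ i < n ] ∑[ j < n ] ⟦ (toℕ j <ᵇ toℕ i) ∧ mem A i j ⟧
      ≡⟨ cong (edges +_) (∑-comm (λ i j → ⟦ (toℕ j <ᵇ toℕ i) ∧ mem A i j ⟧)) ⟩
    edges + ∑[ j < n ] ∑[ i < n ] ⟦ (toℕ j <ᵇ toℕ i) ∧ mem A i j ⟧
      ≡⟨ cong (edges +_) (sum-cong-≗ (λ j → sum-cong-≗ (λ i → cong (λ b → ⟦ (toℕ j <ᵇ toℕ i) ∧ b ⟧) (msym A i j)))) ⟩
    edges + edges
      ≡⟨ cong₂ _+_ (sym (numEdges-∑ (mem A))) (sym (numEdges-∑ (mem A))) ⟩
    size A + size A
      ≡⟨ cong (size A +_) (sym (+-identityʳ (size A))) ⟩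
    2 * size A ∎
    where
    open ≡-Reasoning
    edges = ∑[ i < n ] ∑[ j < n ] ⟦ (toℕ i <ᵇ toℕ j) ∧ mem A i j ⟧

edge-cover : ∀ a s t → ⟦ a ⟧ ≤ ⟦ a ∧ (not s ∧ not t) ⟧ + (⟦ s ⟧ * ⟦ a ⟧ + ⟦ t ⟧ * ⟦ a ⟧)
edge-cover false s     t     = z≤n
edge-cover true  false false = ≤-refl
edge-cover true  false true  = ≤-refl
edge-cover true  true  _     = s≤s z≤n

module _ {n} (G : Graph n) where

  degree-∑ : ∀ v → degree G v ≡ ∑[ j < n ] ⟦ adj G v j ⟧
  degree-∑ v = count-∑ (adj G v)

  degree≤maxDegree : ∀ v → degree G v ≤ maxDegree G
  degree≤maxDegree = foldr-⊔-tabulate (degree G) id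

  degree-sum : ∑[ v < n ] degree G v ≡ 2 * size (Eall G)
  degree-sum = trans (sum-cong-≗ degree-∑) (handshake (Eall G))

  vol : (Fin n → Bool) → ℕ
  vol S = ∑[ v < n ] (⟦ S v ⟧ * degree G v)

  vol≤count*maxDegree : ∀ S → vol S ≤ count S * maxDegree G
  vol≤count*maxDegree S = begin
    ∑[ v < n ] (⟦ S v ⟧ * degree G v)  ≤⟨ ∑-mono-≤ (λ v → *-monoʳ-≤ ⟦ S v ⟧ (degree≤maxDegree v)) ⟩
    ∑[ v < n ] (⟦ S v ⟧ * maxDegree G) ≡⟨ *-distribʳ-sum (maxDegree G) (⟦_⟧ ∘ S) ⟨
    ∑[ v < n ] ⟦ S v ⟧ * maxDegree G   ≡⟨ cong (_* maxDegree G) (count-∑ S) ⟨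
    count S * maxDegree G             ∎
    where open ≤-Reasoning

  degree-positive : ∀ {i j} → adj G i j ≡ true → 0 < degree G i
  degree-positive {i} {j} ij = begin
    1                          ≡⟨ cong ⟦_⟧ ij ⟨
    ⟦ adj G i j ⟧              ≤⟨ ∑-term (λ k → ⟦ adj G i k ⟧) j ⟩
    ∑[ k < n ] ⟦ adj G i k ⟧   ≡⟨ degree-∑ i ⟨
    degree G i                 ∎
    where open ≤-Reasoning

  module _ (reg : Regular G) (i : Fin n) where

    regular-degree-sum : ∑[ v < n ] degree G v ≡ n * degree G i
    regular-degree-sum = trans (sum-cong-≗ (λ v → reg v i)) (∑-const n (degree G i))

    vol-regular : ∀ S → vol S ≡ count S * degree G i
    vol-regular S = begin
      ∑[ v < n ] (⟦ S v ⟧ * degree G v) ≡⟨ sum-cong-≗ (λ v → cong (⟦ S v ⟧ *_) (reg v i)) ⟩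
      ∑[ v < n ] (⟦ S v ⟧ * degree G i) ≡⟨ *-distribʳ-sum (degree G i) (⟦_⟧ ∘ S) ⟨
      ∑[ v < n ] ⟦ S v ⟧ * degree G i   ≡⟨ cong (_* degree G i) (count-∑ S) ⟨
      count S * degree G i              ∎
      where open ≡-Reasoning

  edgesAvoiding : (Fin n → Bool) → EdgeSet G
  edgesAvoiding S = record
    { mem  = restrict (not ∘ S) (adj G)
    ; msym = λ i j → cong₂ _∧_ (adj-sym G i j) (∧-comm (not (S i)) (not (S j)))
    ; sub  = λ i j → proj₁ ∘ ∧≡true {adj G i j}
    }

  components-edgesAvoiding : ∀ S → c (edgesAvoiding S) ≡ count S + cMinus G S
  components-edgesAvoiding S = begin
    components allV (restrict (not ∘ S) (adj G)) ≡⟨ components-restrict (not ∘ S) (adj G) ⟩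
    count (not ∘ not ∘ S) + cMinus G S          ≡⟨ cong (_+ cMinus G S) not-not ⟩
    count S + cMinus G S                        ∎
    where
    open ≡-Reasoning
    not-not : count (not ∘ not ∘ S) ≡ count S
    not-not = trans (count-∑ (not ∘ not ∘ S))
                (trans (sum-cong-≗ (λ v → cong ⟦_⟧ (not-involutive (S v)))) (sym (count-∑ S)))

  vol-by-rows : ∀ S → ∑[ i < n ] ∑[ j < n ] (⟦ S i ⟧ * ⟦ adj G i j ⟧) ≡ vol S
  vol-by-rows S = sum-cong-≗ λ i →
    trans (sym (*-distribˡ-sum ⟦ S i ⟧ (λ j → ⟦ adj G i j ⟧))) (cong (⟦ S i ⟧ *_) (sym (degree-∑ i)))

  vol-by-columns : ∀ S → ∑[ i < n ] ∑[ j < n ] (⟦ S j ⟧ * ⟦ adj G i j ⟧) ≡ vol S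
  vol-by-columns S = begin
    ∑[ i < n ] ∑[ j < n ] (⟦ S j ⟧ * ⟦ adj G i j ⟧) ≡⟨ ∑-comm (λ i j → ⟦ S j ⟧ * ⟦ adj G i j ⟧) ⟩
    ∑[ j < n ] ∑[ i < n ] (⟦ S j ⟧ * ⟦ adj G i j ⟧) ≡⟨ sum-cong-≗ (λ j → sum-cong-≗ (λ i → cong (λ b → ⟦ S j ⟧ * ⟦ b ⟧) (adj-sym G i j))) ⟩
    ∑[ j < n ] ∑[ i < n ] (⟦ S j ⟧ * ⟦ adj G j i ⟧) ≡⟨ vol-by-rows S ⟩
    vol S                                           ∎
    where open ≡-Reasoning

  size≤edgesAvoiding+vol : ∀ S → size (Eall G) ≤ size (edgesAvoiding S) + vol S
  size≤edgesAvoiding+vol S = *-cancelˡ-≤ 2 (begin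
    2 * size (Eall G)
      ≡⟨ handshake (Eall G) ⟨
    ∑[ i < n ] ∑[ j < n ] ⟦ adj G i j ⟧
      ≤⟨ ∑-mono-≤ (λ i → ∑-mono-≤ (λ j → edge-cover (adj G i j) (S i) (S j))) ⟩
    ∑[ i < n ] ∑[ j < n ] (⟦ mem A i j ⟧ + (⟦ S i ⟧ * ⟦ adj G i j ⟧ + ⟦ S j ⟧ * ⟦ adj G i j ⟧))
      ≡⟨ ∑∑-distrib-+ (λ i j → ⟦ mem A i j ⟧) (λ i j → ⟦ S i ⟧ * ⟦ adj G i j ⟧ + ⟦ S j ⟧ * ⟦ adj G i j ⟧) ⟩
    ∑[ i < n ] ∑[ j < n ] ⟦ mem A i j ⟧ + ∑[ i < n ] ∑[ j < n ] (⟦ S i ⟧ * ⟦ adj G i j ⟧ + ⟦ S j ⟧ * ⟦ adj G i j ⟧)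
      ≡⟨ cong₂ _+_ (handshake A) (∑∑-distrib-+ (λ i j → ⟦ S i ⟧ * ⟦ adj G i j ⟧) (λ i j → ⟦ S j ⟧ * ⟦ adj G i j ⟧)) ⟩
    2 * size A + (∑[ i < n ] ∑[ j < n ] (⟦ S i ⟧ * ⟦ adj G i j ⟧) + ∑[ i < n ] ∑[ j < n ] (⟦ S j ⟧ * ⟦ adj G i j ⟧))
      ≡⟨ cong (2 * size A +_) (cong₂ _+_ (vol-by-rows S) (vol-by-columns S)) ⟩
    2 * size A + (vol S + vol S)
      ≡⟨ double (size A) (vol S) ⟩
    2 * (size A + vol S) ∎)
    where
    open ≤-Reasoning
    A = edgesAvoiding S
    double : ∀ a v → 2 * a + (v + v) ≡ 2 * (a + v)
    double = solve-∀

module _ {n} {G : Graph n} where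

  size-positive⇒nonempty : (A : EdgeSet G) → 0 < size A → Nonempty A
  size-positive⇒nonempty A pos with ∑-positive _ (subst (0 <_) (numEdges-∑ (mem A)) pos)
  ... | i , row>0 with ∑-positive _ row>0
  ...   | j , ij>0 = i , j , proj₂ (∧≡true {toℕ i <ᵇ toℕ j} (⟦⟧-positive ij>0))

  uniformlyDense-bound : UniformlyDense G → (A : EdgeSet G) →
    size A * rank (Eall G) ≤ size (Eall G) * rank A
  uniformlyDense-bound ud A with size A in eq
  ... | zero  = z≤n
  ... | suc _ = subst (λ a → a * rank (Eall G) ≤ size (Eall G) * rank A) eq
                  (ud A (size-positive⇒nonempty A (subst (0 <_) (sym eq) z<s)))

≤-from-regular-bound : ∀ {e n d s m} → 0 < n * d → 2 * e ≡ n * d →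
  e * (s + m) ≤ s * d * (n ∸ 1) → m ≤ s
≤-from-regular-bound {e} {n} {d} {s} {m} nd>0 2e≡nd bound =
  +-cancelˡ-≤ s m s (*-cancelˡ-≤ (n * d) {{>-nonZero nd>0}} (begin
    n * d * (s + m)       ≡⟨ cong (_* (s + m)) 2e≡nd ⟨
    2 * e * (s + m)       ≡⟨ *-assoc 2 e (s + m) ⟩
    2 * (e * (s + m))     ≤⟨ *-monoʳ-≤ 2 bound ⟩
    2 * (s * d * (n ∸ 1)) ≤⟨ *-monoʳ-≤ 2 (*-monoʳ-≤ (s * d) (m∸n≤m n 1)) ⟩
    2 * (s * d * n)       ≡⟨ regroup n d s ⟩
    n * d * (s + s)       ∎))
  where
  open ≤-Reasoning
  regroup : ∀ n d s → 2 * (s * d * n) ≡ n * d * (s + s)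
  regroup = solve-∀

module _ {n} (G : Graph n) (ud : UniformlyDense G) where

  removal-bound : ∀ S → size (Eall G) * ((count S + cMinus G S) ∸ cG G) ≤ vol G S * rank (Eall G)
  removal-bound S = begin
    e * ((count S + cMinus G S) ∸ cG G) ≡⟨ cong (λ k → e * (k ∸ cG G)) (components-edgesAvoiding G S) ⟨
    e * (c A ∸ cG G)                    ≡⟨ cong (e *_) ([o∸n]∸[o∸m]≡m∸n (cG G) (components≤ allV (mem A))) ⟨
    e * (rank E ∸ rank A)               ≡⟨ *-distribˡ-∸ e (rank E) (rank A) ⟩
    e * rank E ∸ e * rank A             ≤⟨ m≤n+o⇒m∸n≤o (e * rank E) (e * rank A) density ⟩
    vol G S * rank E                    ∎
    where
    open ≤-Reasoning
    E = Eall G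
    A = edgesAvoiding G S
    e = size E
    density : e * rank E ≤ e * rank A + vol G S * rank E
    density = begin
      e * rank E                          ≤⟨ *-monoˡ-≤ (rank E) (size≤edgesAvoiding+vol G S) ⟩
      (size A + vol G S) * rank E         ≡⟨ *-distribʳ-+ (rank E) (size A) (vol G S) ⟩
      size A * rank E + vol G S * rank E  ≤⟨ +-monoˡ-≤ (vol G S * rank E) (uniformlyDense-bound ud A) ⟩
      e * rank A + vol G S * rank E       ∎

  toughness : ToughFrac G (size (Eall G)) (rank (Eall G) * maxDegree G)
  toughness S = begin
    e * (cMinus G S ∸ cG G)             ≤⟨ *-monoʳ-≤ e (∸-monoˡ-≤ (cG G) (m≤n+m (cMinus G S) (count S))) ⟩
    e * ((count S + cMinus G S) ∸ cG G) ≤⟨ removal-bound S ⟩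
    vol G S * rank (Eall G)             ≤⟨ *-monoˡ-≤ (rank (Eall G)) (vol≤count*maxDegree G S) ⟩
    count S * maxDegree G * rank (Eall G) ≡⟨ reverse (count S) (maxDegree G) (rank (Eall G)) ⟩
    rank (Eall G) * maxDegree G * count S ∎
    where
    open ≤-Reasoning
    e = size (Eall G)
    reverse : ∀ a b c → a * b * c ≡ c * b * a
    reverse = solve-∀

  regular-toughness : Regular G → Connected G → ToughFrac G 1 1
  regular-toughness reg conn S =
    subst₂ _≤_ (sym (*-identityˡ _)) (sym (*-identityˡ _)) (components-bound (cMinus G S) bound)
    where
    e = size (Eall G)
    s = count S
    i₀ = proj₁ (edge G)
    d = degree G i₀

    2e≡nd : 2 * e ≡ n * d
    2e≡nd = trans (sym (degree-sum G)) (regular-degree-sum G reg i₀)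

    nd>0 : 0 < n * d
    nd>0 = *-mono-≤ (Fin-inhabited⇒0<n i₀) (degree-positive G (proj₂ (proj₂ (edge G))))

    bound : e * ((s + cMinus G S) ∸ 1) ≤ s * d * (n ∸ 1)
    bound = subst₂ (λ k v → e * ((s + cMinus G S) ∸ k) ≤ v * (n ∸ k)) conn (vol-regular G reg i₀ S) (removal-bound S)

    components-bound : ∀ k → e * ((s + k) ∸ 1) ≤ s * d * (n ∸ 1) → k ∸ cG G ≤ s
    components-bound k b rewrite conn with k
    ... | zero  = z≤n
    ... | suc m = ≤-from-regular-bound {e} {n} nd>0 2e≡nd (subst (λ x → e * (x ∸ 1) ≤ s * d * (n ∸ 1)) (+-suc s m) b)

theorem3p13 : ∀ {n} (G : Graph n) → UniformlyDense G →
    ToughFrac G (size (Eall G)) (rank (Eall G) * maxDegree G)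
    × (Regular G → Connected G → ToughFrac G 1 1)
theorem3p13 G ud = toughness G ud , regular-toughness G ud
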